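{- For all integers $n\ge 1$ and $l\ge 0$, $v_{ln+1}\equiv v_{ln+2}\pmod{2n}$.
   Context: For an integer $n\ge 1$ let $v_n=\Big[(1-x)\prod_{j=0}^{2n-3}(2n-3-j+jx)\Big]_{x^{n-1}}$, where $[f(x)]_{x^m}$ denotes the coefficient of $x^m$ in $f$ (an empty product equals $1$, so $v_1=1$). -}

module Defs where

open import Data.Nat as ℕ using (ℕ; zero; suc; _∸_)
open import Data.Integer using (ℤ; +_; -[1+_]; _+_; _*_; -_)
open import Data.List using (List; []; _∷_)

-- Polynomials in x with integer coefficients, as coefficient lists
-- (head = constant term).
Poly : Set
Poly = List ℤ

_⊕_ : Poly → Poly → Poly
[] ⊕ q = q
(a ∷ p) ⊕ [] = a ∷ p
(a ∷ p) ⊕ (b ∷ q) = (a + b) ∷ (p ⊕ q)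

_·_ : ℤ → Poly → Poly
c · [] = []
c · (a ∷ p) = (c * a) ∷ (c · p)

_⊗_ : Poly → Poly → Poly
[] ⊗ q = []
(a ∷ p) ⊗ q = (a · q) ⊕ (+ 0 ∷ (p ⊗ q))

coeff : Poly → ℕ → ℤ
coeff [] m = + 0
coeff (a ∷ p) zero = a
coeff (a ∷ p) (suc m) = coeff p m

lin : ℤ → ℤ → Poly
lin a b = a ∷ b ∷ []

prodFrom : ℕ → ℕ → ℕ → Poly
prodFrom N zero j = + 1 ∷ []
prodFrom N (suc k) j = lin (+ (N ∸ j)) (+ j) ⊗ prodFrom N k (suc j)

-- v_n = [ (1 - x) ∏_{j=0}^{2n-3} (2n-3-j + j x) ]_{x^{n-1}}, for n ≥ 1.
-- The product has 2n-2 factors (empty when n = 1); factor j is (2n-3-j) + j x.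
v : ℕ → ℤ
v n = coeff (lin (+ 1) (- (+ 1)) ⊗ prodFrom (2 ℕ.* n ∸ 3) (2 ℕ.* n ∸ 2) 0) (n ∸ 1)

{-# OPTIONS --safe #-}
module Submission where

-- Let P_K = ∏_{j<K} ((K-1-j) + j x), so that v_{m+1} = [(1 - x) P_{2m}]_{x^m}.
-- Suppose M ∣ K. In P_{K+2} the factor j = 0 is K + 1 ≡ 1 and the factor j = K + 1 is
-- (K + 1) x ≡ x (mod M), while for 1 ≤ j ≤ K the factor (K+1-j) + j x is congruent to
-- (1-j) + (j-K) x, the negative of the factor K - j of P_K. Hence
-- P_{K+2} ≡ (-1)^K x P_K (mod M). For K = 2ln and M = 2n the sign is +1, so
-- v_{ln+2} = [(1 - x) P_{K+2}]_{x^{ln+1}} ≡ [(1 - x) x P_K]_{x^{ln+1}} = v_{ln+1}.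

open import Defs

module _ where
  open import Data.Integer
    using (ℤ; +_; -[1+_]; -_; _+_; _*_; _-_; _^_; 0ℤ; 1ℤ; -1ℤ)
  open import Data.Integer.Properties
    using (+-identityˡ; +-identityʳ; *-identityˡ; *-zeroʳ; -1*i≡-i; neg-involutive;
           pos-+; ^-*-assoc; ^-zeroˡ)
  open import Data.Integer.Divisibility.Signed
    using (_∣_; divides; ∣m∣n⇒∣m+n; ∣m⇒∣-m; ∣n⇒∣m*n; ∣m⇒∣m*n)
  open import Data.Integer.Tactic.RingSolver using (solve-∀)
  open import Data.List using ([]; _∷_)
  open import Data.Nat as ℕ using (ℕ; zero; suc; _∸_)
  import Data.Nat.Properties as ℕ
  open import Data.Product using (_×_; _,_; proj₁; proj₂)
  open import Function using (_∘_)
  open import Level using (0ℓ)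
  open import Relation.Binary.Bundles using (Setoid)
  open import Relation.Binary.PropositionalEquality

  -- Coefficient sequences indexed by ℤ, so that multiplication by x is the shift t ↦ t - 1.
  Series : Set
  Series = ℤ → ℤ

  series : Poly → Series
  series p (+ m)    = coeff p m
  series p -[1+ _ ] = 0ℤ

  series-⊕ : ∀ p q t → series (p ⊕ q) t ≡ series p t + series q t
  series-⊕ p       q       -[1+ _ ]  = refl
  series-⊕ []      q       (+ m)     = sym (+-identityˡ _)
  series-⊕ (a ∷ p) []      (+ m)     = sym (+-identityʳ _)
  series-⊕ (a ∷ p) (b ∷ q) (+ zero)  = refl
  series-⊕ (a ∷ p) (b ∷ q) (+ suc m) = series-⊕ p q (+ m)

  series-· : ∀ c p t → series (c · p) t ≡ c * series p t
  series-· c p       -[1+ _ ]  = sym (*-zeroʳ c)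
  series-· c []      (+ m)     = sym (*-zeroʳ c)
  series-· c (a ∷ p) (+ zero)  = refl
  series-· c (a ∷ p) (+ suc m) = series-· c p (+ m)

  series-shift : ∀ p t → series (0ℤ ∷ p) t ≡ series p (t - 1ℤ)
  series-shift p (+ zero)  = refl
  series-shift p (+ suc m) = refl
  series-shift p -[1+ n ]  = refl

  series-zero : ∀ t → series (0ℤ ∷ []) t ≡ 0ℤ
  series-zero (+ zero)  = refl
  series-zero (+ suc m) = refl
  series-zero -[1+ n ]  = refl

  -- (a , b) stands for the linear polynomial a + b x.
  Linear : Set
  Linear = ℤ × ℤ

  neg : Linear → Linear
  neg (a , b) = - a , - b

  infixr 6 _◃_
  _◃_ : Linear → Series → Series
  ((a , b) ◃ F) t = a * F t + b * F (t - 1ℤ)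

  series-lin-⊗ : ∀ a b p → series (lin a b ⊗ p) ≗ (a , b) ◃ series p
  series-lin-⊗ a b p t = begin
    series ((a · p) ⊕ (0ℤ ∷ ((b · p) ⊕ (0ℤ ∷ [])))) t
      ≡⟨ series-⊕ (a · p) _ t ⟩
    series (a · p) t + series (0ℤ ∷ ((b · p) ⊕ (0ℤ ∷ []))) t
      ≡⟨ cong₂ _+_ (series-· a p t) (series-shift _ t) ⟩
    a * series p t + series ((b · p) ⊕ (0ℤ ∷ [])) (t - 1ℤ)
      ≡⟨ cong (λ y → a * series p t + y) (series-⊕ (b · p) _ (t - 1ℤ)) ⟩
    a * series p t + (series (b · p) (t - 1ℤ) + series (0ℤ ∷ []) (t - 1ℤ))
      ≡⟨ cong (λ y → a * series p t + y) (cong₂ _+_ (series-· b p (t - 1ℤ)) (series-zero (t - 1ℤ))) ⟩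
    a * series p t + (b * series p (t - 1ℤ) + 0ℤ)
      ≡⟨ cong (λ y → a * series p t + y) (+-identityʳ _) ⟩
    a * series p t + b * series p (t - 1ℤ) ∎
    where open ≡-Reasoning

  ◃-congʳ : ∀ c {F G} → F ≗ G → c ◃ F ≗ c ◃ G
  ◃-congʳ (a , b) F≗G t = cong₂ (λ x y → a * x + b * y) (F≗G t) (F≗G (t - 1ℤ))

  ◃-comm : ∀ c d F → c ◃ d ◃ F ≗ d ◃ c ◃ F
  ◃-comm (a , b) (c , d) F t = commute a b c d (F t) (F (t - 1ℤ)) (F (t - 1ℤ - 1ℤ))
    where
    commute : ∀ a b c d x y z →
      a * (c * x + d * y) + b * (c * y + d * z) ≡ c * (a * x + b * y) + d * (a * y + b * z)
    commute = solve-∀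

  ◃-identity : ∀ F → (1ℤ , 0ℤ) ◃ F ≗ F
  ◃-identity F t = identity (F t) (F (t - 1ℤ))
    where
    identity : ∀ x y → 1ℤ * x + 0ℤ * y ≡ x
    identity = solve-∀

  ◃-shift : ∀ F → (0ℤ , 1ℤ) ◃ F ≗ F ∘ (_- 1ℤ)
  ◃-shift F t = shift (F t) (F (t - 1ℤ))
    where
    shift : ∀ x y → 0ℤ * x + 1ℤ * y ≡ y
    shift = solve-∀

  ∏ : (ℕ → Linear) → ℕ → ℕ → Series
  ∏ c zero    j = series (1ℤ ∷ [])
  ∏ c (suc k) j = c j ◃ ∏ c k (suc j)

  ∏-snoc : ∀ c k j → ∏ c (suc k) j ≗ c (j ℕ.+ k) ◃ ∏ c k j
  ∏-snoc c zero    j t rewrite ℕ.+-identityʳ j = refl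
  ∏-snoc c (suc k) j t = begin
    (c j ◃ ∏ c (suc k) (suc j)) t              ≡⟨ ◃-congʳ (c j) (∏-snoc c k (suc j)) t ⟩
    (c j ◃ c (suc j ℕ.+ k) ◃ ∏ c k (suc j)) t  ≡⟨ ◃-comm (c j) (c (suc j ℕ.+ k)) (∏ c k (suc j)) t ⟩
    (c (suc j ℕ.+ k) ◃ ∏ c (suc k) j) t        ≡⟨ cong (λ i → (c i ◃ ∏ c (suc k) j) t) (ℕ.+-suc j k) ⟨
    (c (j ℕ.+ suc k) ◃ ∏ c (suc k) j) t        ∎
    where open ≡-Reasoning

  ∏-neg : ∀ c k j t → ∏ (neg ∘ c) k j t ≡ -1ℤ ^ k * ∏ c k j t
  ∏-neg c zero    j t = sym (*-identityˡ _)
  ∏-neg c (suc k) j t = begin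
    - a * ∏ (neg ∘ c) k (suc j) t + - b * ∏ (neg ∘ c) k (suc j) (t - 1ℤ)
      ≡⟨ cong₂ (λ x y → - a * x + - b * y) (∏-neg c k (suc j) t) (∏-neg c k (suc j) (t - 1ℤ)) ⟩
    - a * (s * ∏ c k (suc j) t) + - b * (s * ∏ c k (suc j) (t - 1ℤ))
      ≡⟨ pull-sign a b s _ _ ⟩
    - s * ∏ c (suc k) j t
      ≡⟨ cong (_* ∏ c (suc k) j t) (-1*i≡-i s) ⟨
    -1ℤ * s * ∏ c (suc k) j t ∎
    where
    open ≡-Reasoning
    a b s : ℤ
    a = proj₁ (c j)
    b = proj₂ (c j)
    s = -1ℤ ^ k
    pull-sign : ∀ a b s x y → - a * (s * x) + - b * (s * y) ≡ - s * (a * x + b * y)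
    pull-sign = solve-∀

  -1^[2*n]≡1 : ∀ n → -1ℤ ^ (2 ℕ.* n) ≡ 1ℤ
  -1^[2*n]≡1 n = trans (sym (^-*-assoc -1ℤ 2 n)) (^-zeroˡ n)

  factor : ℕ → ℕ → Linear
  factor N i = + (N ∸ i) , + i

  series-prodFrom : ∀ N k j → series (prodFrom N k j) ≗ ∏ (factor N) k j
  series-prodFrom N zero    j t = refl
  series-prodFrom N (suc k) j t =
    trans (series-lin-⊗ _ _ _ t) (◃-congʳ (factor N j) (series-prodFrom N k (suc j)) t)

  product : ℕ → Series
  product n = ∏ (factor (n ∸ 1)) n 0

  v-suc : ∀ m → v (suc m) ≡ ((1ℤ , -1ℤ) ◃ product (2 ℕ.* m)) (+ m)
  v-suc m = begin
    v (suc m)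
      ≡⟨ cong (λ n → coeff (lin 1ℤ -1ℤ ⊗ prodFrom (n ∸ 3) (n ∸ 2) 0) m) (ℕ.*-suc 2 m) ⟩
    series (lin 1ℤ -1ℤ ⊗ prodFrom (2 ℕ.* m ∸ 1) (2 ℕ.* m) 0) (+ m)
      ≡⟨ series-lin-⊗ 1ℤ -1ℤ (prodFrom (2 ℕ.* m ∸ 1) (2 ℕ.* m) 0) (+ m) ⟩
    ((1ℤ , -1ℤ) ◃ series (prodFrom (2 ℕ.* m ∸ 1) (2 ℕ.* m) 0)) (+ m)
      ≡⟨ ◃-congʳ (1ℤ , -1ℤ) (series-prodFrom (2 ℕ.* m ∸ 1) (2 ℕ.* m) 0) (+ m) ⟩
    ((1ℤ , -1ℤ) ◃ product (2 ℕ.* m)) (+ m) ∎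
    where open ≡-Reasoning

  module Modulo (M : ℤ) where

    infix 4 _≈_ _≈ₗ_ _≋_
    record _≈_ (x y : ℤ) : Set where
      constructor congruent
      field divides-difference : M ∣ x - y
    open _≈_ public

    ≈-reflexive : ∀ {x y} → x ≡ y → x ≈ y
    ≈-reflexive {x} refl = congruent (divides 0ℤ (difference-self x M))
      where
      difference-self : ∀ x M → x - x ≡ 0ℤ * M
      difference-self = solve-∀

    ≈-refl : ∀ {x} → x ≈ x
    ≈-refl = ≈-reflexive refl

    ≈-sym : ∀ {x y} → x ≈ y → y ≈ x
    ≈-sym {x} {y} (congruent M∣x-y) = congruent (subst (M ∣_) (flip x y) (∣m⇒∣-m M∣x-y))
      where
      flip : ∀ x y → - (x - y) ≡ y - x
      flip = solve-∀

    ≈-trans : ∀ {x y z} → x ≈ y → y ≈ z → x ≈ z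
    ≈-trans {x} {y} {z} (congruent M∣x-y) (congruent M∣y-z) =
      congruent (subst (M ∣_) (telescope x y z) (∣m∣n⇒∣m+n M∣x-y M∣y-z))
      where
      telescope : ∀ x y z → (x - y) + (y - z) ≡ x - z
      telescope = solve-∀

    ≈-setoid : Setoid 0ℓ 0ℓ
    ≈-setoid = record
      { Carrier = ℤ
      ; _≈_ = _≈_
      ; isEquivalence = record { refl = ≈-refl ; sym = ≈-sym ; trans = ≈-trans }
      }

    +-cong : ∀ {x x′ y y′} → x ≈ x′ → y ≈ y′ → x + y ≈ x′ + y′
    +-cong {x} {x′} {y} {y′} (congruent M∣x-x′) (congruent M∣y-y′) =
      congruent (subst (M ∣_) (regroup x x′ y y′) (∣m∣n⇒∣m+n M∣x-x′ M∣y-y′))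
      where
      regroup : ∀ x x′ y y′ → (x - x′) + (y - y′) ≡ (x + y) - (x′ + y′)
      regroup = solve-∀

    *-cong : ∀ {x x′ y y′} → x ≈ x′ → y ≈ y′ → x * y ≈ x′ * y′
    *-cong {x} {x′} {y} {y′} (congruent M∣x-x′) (congruent M∣y-y′) =
      congruent (subst (M ∣_) (regroup x x′ y y′) (∣m∣n⇒∣m+n (∣n⇒∣m*n x M∣y-y′) (∣m⇒∣m*n y′ M∣x-x′)))
      where
      regroup : ∀ x x′ y y′ → x * (y - y′) + (x - x′) * y′ ≡ x * y - x′ * y′
      regroup = solve-∀

    ≈-neg : ∀ {K m n} → M ∣ + K → m ℕ.+ n ≡ K → + m ≈ - + n
    ≈-neg {K} {m} {n} M∣K refl = congruent (subst (M ∣_) (sym sum) M∣K)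
      where
      sum : + m - - + n ≡ + (m ℕ.+ n)
      sum = trans (cong (λ y → + m + y) (neg-involutive (+ n))) (sym (pos-+ m n))

    _≈ₗ_ : Linear → Linear → Set
    (a , b) ≈ₗ (a′ , b′) = a ≈ a′ × b ≈ b′

    ≈ₗ-refl : ∀ c → c ≈ₗ c
    ≈ₗ-refl c = ≈-refl , ≈-refl

    _≋_ : Series → Series → Set
    F ≋ G = ∀ t → F t ≈ G t

    ◃-cong : ∀ {c d F G} → c ≈ₗ d → F ≋ G → c ◃ F ≋ d ◃ G
    ◃-cong (a≈a′ , b≈b′) F≋G t = +-cong (*-cong a≈a′ (F≋G t)) (*-cong b≈b′ (F≋G (t - 1ℤ)))

    ◃-congˡ : ∀ {c d} → c ≈ₗ d → ∀ F → c ◃ F ≋ d ◃ F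
    ◃-congˡ c≈d F = ◃-cong c≈d (λ _ → ≈-refl)

    ∏-reverse-cong : ∀ {c c′} k j j′ →
      (∀ {i d} → suc (i ℕ.+ d) ≡ k → c (j ℕ.+ i) ≈ₗ c′ (j′ ℕ.+ d)) →
      ∏ c k j ≋ ∏ c′ k j′
    ∏-reverse-cong         zero    j j′ _       t = ≈-refl
    ∏-reverse-cong {c} {c′} (suc k) j j′ matched t = begin
      (c j ◃ ∏ c k (suc j)) t       ≈⟨ ◃-cong first (∏-reverse-cong k (suc j) j′ rest) t ⟩
      (c′ (j′ ℕ.+ k) ◃ ∏ c′ k j′) t  ≡⟨ ∏-snoc c′ k j′ t ⟨
      ∏ c′ (suc k) j′ t              ∎
      where
      open import Relation.Binary.Reasoning.Setoid ≈-setoid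
      first : c j ≈ₗ c′ (j′ ℕ.+ k)
      first = subst (λ i → c i ≈ₗ c′ (j′ ℕ.+ k)) (ℕ.+-identityʳ j) (matched {0} {k} refl)
      rest : ∀ {i d} → suc (i ℕ.+ d) ≡ k → c (suc j ℕ.+ i) ≈ₗ c′ (j′ ℕ.+ d)
      rest {i} {d} eq = subst (λ n → c n ≈ₗ c′ (j′ ℕ.+ d)) (ℕ.+-suc j i) (matched (cong suc eq))

    factor-reflection : ∀ {K i d} → M ∣ + K → suc (i ℕ.+ d) ≡ K →
      factor (suc K) (suc i) ≈ₗ neg (factor (K ∸ 1) d)
    factor-reflection {i = i} {d} M∣K refl =
      ≈-neg M∣K (trans (cong (suc (i ℕ.+ d) ∸ i ℕ.+_) (ℕ.m+n∸n≡m i d))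
                       (ℕ.m∸n+n≡m (ℕ.m≤n⇒m≤1+n (ℕ.m≤m+n i d)))) ,
      ≈-neg M∣K refl

    product-2+ : ∀ {K} → M ∣ + K → product (2 ℕ.+ K) ≋ λ t → -1ℤ ^ K * product K (t - 1ℤ)
    product-2+ {K} M∣K t = begin
      (b 0 ◃ ∏ b (suc K) 1) t               ≈⟨ ◃-congˡ constant-factor (∏ b (suc K) 1) t ⟩
      ((1ℤ , 0ℤ) ◃ ∏ b (suc K) 1) t         ≡⟨ ◃-identity (∏ b (suc K) 1) t ⟩
      ∏ b (suc K) 1 t                       ≡⟨ ∏-snoc b K 1 t ⟩
      (b (suc K) ◃ ∏ b K 1) t               ≈⟨ ◃-congˡ top-factor (∏ b K 1) t ⟩
      ((0ℤ , 1ℤ) ◃ ∏ b K 1) t               ≡⟨ ◃-shift (∏ b K 1) t ⟩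
      ∏ b K 1 (t - 1ℤ)                      ≈⟨ ∏-reverse-cong K 1 0 (factor-reflection M∣K) (t - 1ℤ) ⟩
      ∏ (neg ∘ factor (K ∸ 1)) K 0 (t - 1ℤ) ≡⟨ ∏-neg (factor (K ∸ 1)) K 0 (t - 1ℤ) ⟩
      -1ℤ ^ K * product K (t - 1ℤ)          ∎
      where
      open import Relation.Binary.Reasoning.Setoid ≈-setoid
      b : ℕ → Linear
      b = factor (suc K)
      constant-factor : b 0 ≈ₗ (1ℤ , 0ℤ)
      constant-factor = congruent M∣K , ≈-refl
      top-factor : b (suc K) ≈ₗ (0ℤ , 1ℤ)
      top-factor = ≈-reflexive (cong +_ (ℕ.n∸n≡0 K)) , congruent M∣K

  v-congruence : ∀ {M} L → M ∣ + (2 ℕ.* L) → M ∣ v (suc L) - v (suc (suc L))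
  v-congruence {M} L M∣2L = divides-difference (≈-sym (begin
    v (suc (suc L))
      ≡⟨ v-suc (suc L) ⟩
    ((1ℤ , -1ℤ) ◃ product (2 ℕ.* suc L)) (+ suc L)
      ≡⟨ cong (λ n → ((1ℤ , -1ℤ) ◃ product n) (+ suc L)) (ℕ.*-suc 2 L) ⟩
    ((1ℤ , -1ℤ) ◃ product (2 ℕ.+ 2 ℕ.* L)) (+ suc L)
      ≈⟨ ◃-cong (≈ₗ-refl (1ℤ , -1ℤ)) (product-2+ M∣2L) (+ suc L) ⟩
    ((1ℤ , -1ℤ) ◃ λ t → -1ℤ ^ (2 ℕ.* L) * product (2 ℕ.* L) (t - 1ℤ)) (+ suc L)
      ≡⟨ ◃-congʳ (1ℤ , -1ℤ) unsigned (+ suc L) ⟩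
    ((1ℤ , -1ℤ) ◃ product (2 ℕ.* L) ∘ (_- 1ℤ)) (+ suc L)
      ≡⟨ v-suc L ⟨
    v (suc L) ∎))
    where
    open Modulo M
    open import Relation.Binary.Reasoning.Setoid ≈-setoid
    unsigned : (λ t → -1ℤ ^ (2 ℕ.* L) * product (2 ℕ.* L) (t - 1ℤ)) ≗ product (2 ℕ.* L) ∘ (_- 1ℤ)
    unsigned t = trans (cong (_* product (2 ℕ.* L) (t - 1ℤ)) (-1^[2*n]≡1 L)) (*-identityˡ _)

open import Data.Nat using (ℕ; _+_; _*_; _≤_)
open import Data.Integer using (+_; _-_)
open import Data.Integer.Divisibility using (_∣_)

open import Data.Integer.Divisibility.Signed using (divides; ∣⇒∣ᵤ)
open import Data.Integer.Properties using (pos-*)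
open import Data.Nat.Properties using (+-comm; *-comm; *-assoc)
open import Relation.Binary.PropositionalEquality using (_≡_; cong; sym; trans)

mainTheorem7 : (n l : ℕ) → 1 ≤ n →
    (+ (2 * n)) ∣ (v (l * n + 1) - v (l * n + 2))
mainTheorem7 n l _ rewrite +-comm (l * n) 1 | +-comm (l * n) 2 =
  ∣⇒∣ᵤ (v-congruence (l * n) (divides (+ l) (trans (cong +_ 2*ln≡l*2n) (pos-* l (2 * n)))))
  where
  2*ln≡l*2n : 2 * (l * n) ≡ l * (2 * n)
  2*ln≡l*2n = trans (sym (*-assoc 2 l n)) (trans (cong (_* n) (*-comm 2 l)) (*-assoc l 2 n))
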